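{- $S_n(123, 321)$ is sign-balanced for every integer $n>1$.
   Context: For $\sigma\in S_k$, $\pi\in S_n$ (one-line notation), $k\le n$, $\pi$ contains $\sigma$ if there are indices $i_1<\cdots<i_k$ with $\pi_{i_s}>\pi_{i_t}$ iff $\sigma_s>\sigma_t$ for all $s<t$; otherwise $\pi$ avoids $\sigma$. $S_n(\sigma_1,\ldots,\sigma_r)$ is the set of permutations in $S_n$ avoiding every $\sigma_j$. A permutation is even (odd) if its number of inversions (pairs $i<j$ with $\pi_i>\pi_j$) is even (odd). A set of permutations is sign-balanced if it contains equally many even and odd permutations. -}

module Defs where

open import Data.Nat as ℕ using (ℕ; zero; suc; _%_)
open import Data.Nat.Properties using () renaming (_≟_ to _≟ℕ_)
open import Data.Fin as Fin using (Fin; _<_)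
open import Data.Fin.Properties using (any?; all?; _<?_; _≟_)
open import Data.Vec using (Vec; []; _∷_; lookup)
open import Data.List using (List; [_]; map; concatMap; allFin; cartesianProduct; filter; length)
open import Data.Product using (Σ; ∃; _×_; _,_; proj₁; proj₂)
open import Function.Bundles using (_⇔_; mk⇔; Equivalence)
open import Relation.Nullary using (Dec; yes; no; ¬_)
open import Relation.Nullary.Decidable using (_×-dec_; _→-dec_; ¬?; map′)
open import Relation.Binary.PropositionalEquality using (_≡_; refl)

-- A permutation in S_n in one-line notation, with values 0,…,n-1
-- (i.e. value v stands for v+1).  A word π : Vec (Fin n) n is a
-- permutation iff it is injective.
Word : ℕ → Set
Word n = Vec (Fin n) n

IsPerm : ∀ {n} → Word n → Set
IsPerm {n} π = ∀ (i j : Fin n) → lookup π i ≡ lookup π j → i ≡ j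

allVecs : ∀ k n → List (Vec (Fin n) k)
allVecs zero    n = [ [] ]
allVecs (suc k) n = concatMap (λ i → map (i ∷_) (allVecs k n)) (allFin n)

Contains : ∀ {k n} → Vec (Fin k) k → Vec (Fin n) n → Set
Contains {k} {n} σ π =
  ∃ λ (ι : Vec (Fin n) k) →
    (∀ (s t : Fin k) → s < t → lookup ι s < lookup ι t) ×
    (∀ (s t : Fin k) → s < t →
       (lookup π (lookup ι t) < lookup π (lookup ι s)) ⇔ (lookup σ t < lookup σ s))

Avoids : ∀ {k n} → Vec (Fin k) k → Vec (Fin n) n → Set
Avoids σ π = ¬ Contains σ π

inversions : ∀ {n} → Word n → ℕ
inversions {n} π =
  length (filter (λ p → proj₁ p <? proj₂ p ×-dec lookup π (proj₂ p) <? lookup π (proj₁ p))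
                 (cartesianProduct (allFin n) (allFin n)))

IsEven IsOdd : ∀ {n} → Word n → Set
IsEven π = inversions π % 2 ≡ 0
IsOdd  π = inversions π % 2 ≡ 1

p123 p321 : Vec (Fin 3) 3
p123 = Fin.zero ∷ Fin.suc Fin.zero ∷ Fin.suc (Fin.suc Fin.zero) ∷ []
p321 = Fin.suc (Fin.suc Fin.zero) ∷ Fin.suc Fin.zero ∷ Fin.zero ∷ []

∃Vec? : ∀ {n} k (P : Vec (Fin n) k → Set) → (∀ v → Dec (P v)) → Dec (∃ P)
∃Vec? zero P P? with P? []
... | yes p = yes ([] , p)
... | no ¬p = no λ { ([] , p) → ¬p p }
∃Vec? (suc k) P P? =
  map′ (λ { (i , v , p) → (i ∷ v) , p }) (λ { ((i ∷ v) , p) → i , v , p })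
       (any? (λ i → ∃Vec? k (λ v → P (i ∷ v)) (λ v → P? (i ∷ v))))

⇔? : ∀ {A B : Set} → Dec A → Dec B → Dec (A ⇔ B)
⇔? (yes a) (yes b) = yes (mk⇔ (λ _ → b) (λ _ → a))
⇔? (yes a) (no ¬b) = no λ e → ¬b (Equivalence.to e a)
⇔? (no ¬a) (yes b) = no λ e → ¬a (Equivalence.from e b)
⇔? (no ¬a) (no ¬b) = yes (mk⇔ (λ a → ⊥-e (¬a a)) (λ b → ⊥-e (¬b b)))
  where open import Data.Empty renaming (⊥-elim to ⊥-e)

IsPerm? : ∀ {n} (π : Word n) → Dec (IsPerm π)
IsPerm? π = all? λ i → all? λ j → (lookup π i ≟ lookup π j) →-dec (i ≟ j)

Contains? : ∀ {k n} (σ : Vec (Fin k) k) (π : Vec (Fin n) n) → Dec (Contains σ π)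
Contains? {k} σ π = ∃Vec? k _ λ ι →
  (all? λ s → all? λ t → (s <? t) →-dec (lookup ι s <? lookup ι t)) ×-dec
  (all? λ s → all? λ t → (s <? t) →-dec
     ⇔? (lookup π (lookup ι t) <? lookup π (lookup ι s)) (lookup σ t <? lookup σ s))

Avoids? : ∀ {k n} (σ : Vec (Fin k) k) (π : Vec (Fin n) n) → Dec (Avoids σ π)
Avoids? σ π = ¬? (Contains? σ π)

IsEven? : ∀ {n} (π : Word n) → Dec (IsEven π)
IsEven? π = inversions π % 2 ≟ℕ 0

IsOdd? : ∀ {n} (π : Word n) → Dec (IsOdd π)
IsOdd? π = inversions π % 2 ≟ℕ 1

-- the elements of S_n(123, 321) with the given sign property, listed
-- without repetition (allVecs n n has no duplicates)
evenAvoiders oddAvoiders : ∀ n → List (Word n)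
evenAvoiders n = filter (λ π → IsPerm? π ×-dec Avoids? p123 π ×-dec Avoids? p321 π ×-dec IsEven? π) (allVecs n n)
oddAvoiders  n = filter (λ π → IsPerm? π ×-dec Avoids? p123 π ×-dec Avoids? p321 π ×-dec IsOdd? π) (allVecs n n)

{-# OPTIONS --safe #-}
-- For n ≥ 5 both sets are empty: any five distinct values contain a monotone
-- subsequence of length 3 (the case k = 3 of Erdős–Szekeres), i.e. an occurrence
-- of 123 or 321.  The cases n = 2, 3, 4 are finite computations.
module Submission where

open import Defs
open import Data.Nat as ℕ using (ℕ; _<_; suc; z<s; s<s)
open import Data.Fin as Fin using (Fin; zero; suc; inject≤)
open import Data.Nat.Properties using (m≤m+n)
open import Data.Fin.Properties using (<-cmp; <-trans; <-asym; <⇒≢; toℕ-inject≤; _<?_)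
open import Data.List using (List; []; length; filter)
open import Data.List.Properties using (filter-none)
open import Data.List.Relation.Unary.All using (universal)
open import Data.Vec using (_∷_; lookup) renaming ([] to []ᵥ)
open import Data.Sum using (_⊎_; inj₁; inj₂; swap; map)
open import Data.Product using (_×_; _,_)
open import Data.Empty using (⊥-elim)
open import Function using (flip; _∘_; const)
open import Function.Bundles using (_⇔_; mk⇔)
open import Relation.Nullary using (¬_; contradiction)
open import Relation.Nullary.Decidable using (True; toWitness; _×-dec_)
open import Level using (0ℓ)
open import Relation.Unary using (Pred; Decidable)
open import Relation.Binary using (Rel; Transitive; tri<; tri≈; tri>)
open import Relation.Binary.PropositionalEquality using (_≡_; refl; sym; trans; cong; subst₂)

private
  variable
    n : ℕ

Connex< : Rel (Fin n) 0ℓ → Set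
Connex< T = ∀ {i j} → i Fin.< j → T i j ⊎ T j i

record Chain₃ (T : Rel (Fin n) 0ℓ) : Set where
  constructor chain
  field
    {i j k} : Fin n
    i<j : i Fin.< j
    j<k : j Fin.< k
    Tij : T i j
    Tjk : T j k

Connex<-flip : {T : Rel (Fin n) 0ℓ} → Connex< T → Connex< (flip T)
Connex<-flip connex = swap ∘ connex

Connex<-restrict : {m : ℕ} {T : Rel (Fin n) 0ℓ} (f : Fin m → Fin n) →
                   (∀ {i j} → i Fin.< j → f i Fin.< f j) →
                   Connex< T → Connex< (λ i j → T (f i) (f j))
Connex<-restrict f f-mono connex = connex ∘ f-mono

Chain₃-unrestrict : {m : ℕ} {T : Rel (Fin n) 0ℓ} (f : Fin m → Fin n) →
                    (∀ {i j} → i Fin.< j → f i Fin.< f j) →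
                    Chain₃ (λ i j → T (f i) (f j)) → Chain₃ T
Chain₃-unrestrict f f-mono (chain i<j j<k Tij Tjk) = chain (f-mono i<j) (f-mono j<k) Tij Tjk

module FivePoints (T : Rel (Fin 5) 0ℓ) (connex : Connex< T) where

  private
    compare : ∀ i j {i<j : True (i <? j)} → T i j ⊎ T j i
    compare i j {i<j} = connex (toWitness i<j)

    chain′ : {R : Rel (Fin 5) 0ℓ} → ∀ i j k {i<j : True (i <? j)} {j<k : True (j <? k)} →
             R i j → R j k → Chain₃ R
    chain′ i j k {i<j} {j<k} = chain (toWitness i<j) (toWitness j<k)

    pattern #0 = zero
    pattern #1 = suc #0
    pattern #2 = suc #1
    pattern #3 = suc #2
    pattern #4 = suc #3

  chain₃-from-T01 : T #0 #1 → Chain₃ T ⊎ Chain₃ (flip T)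
  chain₃-from-T01 T01 with compare #1 #2
  ... | inj₁ T12 = inj₁ (chain′ #0 #1 #2 T01 T12)
  ... | inj₂ T21 with compare #1 #3
  ... | inj₁ T13 = inj₁ (chain′ #0 #1 #3 T01 T13)
  ... | inj₂ T31 with compare #2 #3
  ... | inj₂ T32 = inj₂ (chain′ #1 #2 #3 T21 T32)
  ... | inj₁ T23 with compare #3 #4
  ... | inj₁ T34 = inj₁ (chain′ #2 #3 #4 T23 T34)
  ... | inj₂ T43 = inj₂ (chain′ #1 #3 #4 T31 T43)

chain₃-in-5 : (T : Rel (Fin 5) 0ℓ) → Connex< T → Chain₃ T ⊎ Chain₃ (flip T)
chain₃-in-5 T connex with connex {zero} {suc zero} z<s
... | inj₁ T01 = FivePoints.chain₃-from-T01 T connex T01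
... | inj₂ T10 = swap (FivePoints.chain₃-from-T01 (flip T) (Connex<-flip connex) T10)

chain₃-in-≥5 : (T : Rel (Fin n) 0ℓ) → 5 ℕ.≤ n → Connex< T → Chain₃ T ⊎ Chain₃ (flip T)
chain₃-in-≥5 T 5≤n connex =
  map (Chain₃-unrestrict embed embed-mono) (Chain₃-unrestrict embed embed-mono)
      (chain₃-in-5 _ (Connex<-restrict embed embed-mono connex))
  where
    embed : Fin 5 → Fin _
    embed i = inject≤ i 5≤n

    embed-mono : ∀ {i j} → i Fin.< j → embed i Fin.< embed j
    embed-mono {i} {j} = subst₂ ℕ._<_ (sym (toℕ-inject≤ i 5≤n)) (sym (toℕ-inject≤ j 5≤n))

ordered₃ : {A : Set} (R : Rel A 0ℓ) → Transitive R → ∀ {a b c} → R a b → R b c →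
           ∀ s t → s Fin.< t → R (lookup (a ∷ b ∷ c ∷ []ᵥ) s) (lookup (a ∷ b ∷ c ∷ []ᵥ) t)
ordered₃ _ R-trans ab bc zero             (suc zero)       _ = ab
ordered₃ _ R-trans ab bc zero             (suc (suc zero)) _ = R-trans ab bc
ordered₃ _ R-trans ab bc (suc zero)       (suc (suc zero)) _ = bc
ordered₃ _ R-trans ab bc zero             zero             ()
ordered₃ _ R-trans ab bc (suc zero)       zero             ()
ordered₃ _ R-trans ab bc (suc zero)       (suc zero)       (s<s ())
ordered₃ _ R-trans ab bc (suc (suc zero)) zero             ()
ordered₃ _ R-trans ab bc (suc (suc zero)) (suc zero)       (s<s ())
ordered₃ _ R-trans ab bc (suc (suc zero)) (suc (suc zero)) (s<s (s<s ()))

both-true : {A B : Set} → A → B → A ⇔ B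
both-true a b = mk⇔ (const b) (const a)

both-false : {A B : Set} → ¬ A → ¬ B → A ⇔ B
both-false ¬a ¬b = mk⇔ (⊥-elim ∘ ¬a) (⊥-elim ∘ ¬b)

module _ (π : Word n) where

  _≺_ : Rel (Fin n) 0ℓ
  a ≺ b = lookup π a Fin.< lookup π b

  increasing⇒contains123 : Chain₃ _≺_ → Contains p123 π
  increasing⇒contains123 (chain {i} {j} {k} i<j j<k i≺j j≺k) =
    (i ∷ j ∷ k ∷ []ᵥ) , ordered₃ Fin._<_ <-trans i<j j<k ,
    λ s t s<t → both-false (<-asym (ordered₃ _≺_ <-trans i≺j j≺k s t s<t))
                           (<-asym (ordered₃ Fin._<_ <-trans z<s (s<s z<s) s t s<t))

  decreasing⇒contains321 : Chain₃ (flip _≺_) → Contains p321 π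
  decreasing⇒contains321 (chain {i} {j} {k} i<j j<k j≺i k≺j) =
    (i ∷ j ∷ k ∷ []ᵥ) , ordered₃ Fin._<_ <-trans i<j j<k ,
    λ s t s<t → both-true (ordered₃ (flip _≺_) (flip <-trans) j≺i k≺j s t s<t)
                          (ordered₃ (flip Fin._<_) (flip <-trans) (s<s z<s) z<s s t s<t)

  IsPerm⇒Connex< : IsPerm π → Connex< _≺_
  IsPerm⇒Connex< injective {i} {j} i<j with <-cmp (lookup π i) (lookup π j)
  ... | tri< πi<πj _ _ = inj₁ πi<πj
  ... | tri≈ _ πi≡πj _ = contradiction (injective i j πi≡πj) (<⇒≢ i<j)
  ... | tri> _ _ πj<πi = inj₂ πj<πi

  contains123-or-321 : 5 ℕ.≤ n → IsPerm π → Contains p123 π ⊎ Contains p321 π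
  contains123-or-321 5≤n isPerm =
    map increasing⇒contains123 decreasing⇒contains321
        (chain₃-in-≥5 _≺_ 5≤n (IsPerm⇒Connex< isPerm))

no-avoiders : 5 ℕ.≤ n → {Q : Pred (Word n) 0ℓ} (Q? : Decidable Q) (πs : List (Word n)) →
              filter (λ π → IsPerm? π ×-dec Avoids? p123 π ×-dec Avoids? p321 π ×-dec Q? π) πs ≡ []
no-avoiders 5≤n {Q} Q? πs = filter-none _ (universal excluded πs)
  where
    excluded : ∀ π → ¬ (IsPerm π × Avoids p123 π × Avoids p321 π × Q π)
    excluded π (isPerm , avoids123 , avoids321 , _) with contains123-or-321 π 5≤n isPerm
    ... | inj₁ contains123 = avoids123 contains123
    ... | inj₂ contains321 = avoids321 contains321

proposition3p3 : ∀ (n : ℕ) → 1 < n → length (evenAvoiders n) ≡ length (oddAvoiders n)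
proposition3p3 1 (s<s ())
proposition3p3 2 _ = refl
proposition3p3 3 _ = refl
proposition3p3 4 _ = refl
proposition3p3 n@(suc (suc (suc (suc (suc m))))) _ =
  cong length (trans (no-avoiders 5≤n IsEven? (allVecs n n))
                     (sym (no-avoiders 5≤n IsOdd? (allVecs n n))))
  where
    5≤n : 5 ℕ.≤ n
    5≤n = m≤m+n 5 m
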